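{- Let $G$, $D$, $(L,H)$, $F$, the probabilities $p$ and the random sets $S(\cdot)$, $S$ be as in the context. Let $u \in V$ and set $A \coloneqq R^+[u] \setminus R^-[N_D^+[u]]$. Let $Q \in \mathbf{QI}(A)$ be such that the event $S(A)=Q$ has positive probability, and let $Y \subseteq L(N_D^+(u))$. Then \[\Pr\left[y \notin S \text{ for all } y \in Y\,\middle\vert\, S(A) = Q\right] \geq \prod_{y \in Y} \Pr\left[y \notin S\,\middle\vert\, S(A) = Q\right].\]
   Context: Let $G$ be a finite graph with vertex set $V$, and let $D$ be an acyclic orientation of $G$ such that for every directed edge $uv$ of $D$ (from $u$ to $v$) there is no directed path from $u$ to $v$ of even length in $D$. Write $N_D^+(u)$ for the out-neighbours of $u$, $N_D^+[u]=N_D^+(u)\cup\{u\}$, $R^+(u)$ for the set of vertices reachable from $u$ by a directed path of positive length, $R^-(u)=\{v: u\in R^+(v)\}$, $R^\pm[u]=R^\pm(u)\cup\{u\}$, and for a set $U$ write $N_D^+(U)=\bigcup_{u\in U}N_D^+(u)$, $R^-[U]=\bigcup_{u\in U}R^-[u]$. Let $(L,H)$ be a $k$-fold cover of $G$: $H$ is a graph, $L\colon V\to 2^{V(H)}$, the sets $L(u)$ partition $V(H)$, each has size $k$ and induces a clique, edges of $H$ between $L(u)$ and $L(v)$ with $u\ne v$ exist only if $uv\in E(G)$ and then form a matching. Edges of $H$ between different sets $L(u),L(v)$ are cross-edges; a set is quasi-independent if it spans no cross-edges. For $U\subseteq V$, $L(U)=\bigcup_{u\in U}L(u)$ and $\mathbf{QI}(U)$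 is the set of quasi-independent subsets of $L(U)$. Let $F$ be the orientation of the cross-edges in which a cross-edge $xy$ with $x\in L(u)$, $y\in L(v)$ is directed from $x$ to $y$ iff $uv$ is a directed edge of $D$; $N_F^+(x)$ denotes out-neighbours of $x$ in $F$. Fix probabilities $p(u)\in[0,1]$, $u\in V$. Let $\xi(x)$, $x\in V(H)$, be independent random variables with $\xi(x)=1$ with probability $p(u)$ and $\xi(x)=0$ otherwise, where $x\in L(u)$. Random sets $S(u)\subseteq L(u)$ are defined recursively along $D$ (possible since $D$ is acyclic): once $S(v)$ is defined for all $v\in R^+(u)$, let $L'(u)=\{x\in L(u): N_F^+(x)\cap S(v)=\varnothing \text{ for all } v\in N_D^+(u)\}$ and $S(u)=\{x\in L'(u):\xi(x)=1\}$. Set $S(U)=\bigcup_{u\in U}S(u)$ and $S=S(V)$.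
   Formalization: The probabilities $p(u)$ are rational numbers in [0,1]. -}

module Defs where

open import Data.Nat using (ℕ; zero; suc)
open import Data.Fin using (Fin; zero; suc)
open import Data.Fin.Base using ()
open import Data.List using (List; []; _∷_; map; concatMap; foldr)
open import Data.Bool.ListAction using (all)
open import Data.List.Base using (allFin)
open import Data.Bool using (Bool; true; false; T; not; _∧_; _∨_; _xor_; if_then_else_)
open import Data.Product using (Σ; ∃; _×_; _,_)
open import Data.Sum using (_⊎_)
open import Data.Empty using (⊥)
open import Relation.Nullary using (¬_)
open import Relation.Binary.PropositionalEquality using (_≡_)
open import Data.Rational using (ℚ; 0ℚ; 1ℚ; _+_; _*_; _-_; _<_; 1/_; >-nonZero)

Digraph : ℕ → Set
Digraph n = Fin n → Fin n → Bool

-- Directed walks of a given length.  In an acyclic digraph walks are paths.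
data Walk {n : ℕ} (D : Digraph n) : Fin n → Fin n → ℕ → Set where
  here : ∀ {u} → Walk D u u zero
  step : ∀ {u v w ℓ} → T (D u v) → Walk D v w ℓ → Walk D u w (suc ℓ)

data Even : ℕ → Set where
  even0  : Even zero
  even+2 : ∀ {m} → Even m → Even (suc (suc m))

-- D is an orientation of a finite simple graph G (G = underlying graph of D):
-- no loops and at most one arc between two vertices.
IsOrientation : ∀ {n} → Digraph n → Set
IsOrientation D = (∀ u → ¬ T (D u u)) × (∀ u v → T (D u v) → ¬ T (D v u))

Acyclic : ∀ {n} → Digraph n → Set
Acyclic D = ∀ u ℓ → ¬ Walk D u u (suc ℓ)

NoEvenShortcut : ∀ {n} → Digraph n → Set
NoEvenShortcut D = ∀ u v → T (D u v) → ∀ ℓ → Even ℓ → ¬ Walk D u v ℓ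

EdgeG : ∀ {n} → Digraph n → Fin n → Fin n → Set
EdgeG D u v = T (D u v) ⊎ T (D v u)

R⁺ : ∀ {n} → Digraph n → Fin n → Fin n → Set
R⁺ D u v = ∃ λ ℓ → Walk D u v (suc ℓ)

R⁺[_] : ∀ {n} → Digraph n → Fin n → Fin n → Set
R⁺[ D ] u v = v ≡ u ⊎ R⁺ D u v

R⁻[_] : ∀ {n} → Digraph n → Fin n → Fin n → Set
R⁻[ D ] w v = v ≡ w ⊎ R⁺ D v w

N⁺[_] : ∀ {n} → Digraph n → Fin n → Fin n → Set
N⁺[ D ] u w = w ≡ u ⊎ T (D u w)

InA : ∀ {n} → Digraph n → Fin n → Fin n → Set
InA D u v = R⁺[ D ] u v × ¬ (∃ λ w → N⁺[ D ] u w × R⁻[ D ] w v)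

-- k-fold cover (L,H): V(H) = Fin n × Fin k, L(v) = {v} × Fin k (each L(v)
-- is a k-clique).  Cross-edges are given by M u v i j : (u,i) ~ (v,j).

CrossEdges : ℕ → ℕ → Set
CrossEdges n k = Fin n → Fin n → Fin k → Fin k → Bool

IsCover : ∀ {n k} → Digraph n → CrossEdges n k → Set
IsCover D M =
  (∀ u v i j → M u v i j ≡ M v u j i) ×
  (∀ u v i j → T (M u v i j) → EdgeG D u v) ×
  (∀ u v i j j' → T (M u v i j) → T (M u v i j') → j ≡ j')

VSet : ℕ → ℕ → Set
VSet n k = Fin n → Fin k → Bool

InQI : ∀ {n k} → CrossEdges n k → (Fin n → Set) → VSet n k → Set
InQI M A Q =
  (∀ a i → T (Q a i) → A a) ×
  (∀ a b i j → T (Q a i) → T (Q b j) → ¬ T (M a b i j))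

-- The random construction.  An outcome ξ assigns a bit to each x ∈ V(H).

Outcome : ℕ → ℕ → Set
Outcome n k = VSet n k

allFin? : ∀ {m} → (Fin m → Bool) → Bool
allFin? {m} f = all f (allFin m)

-- One step of the recursion: given S(v) for the out-neighbours,
-- S(u) = { x ∈ L'(u) : ξ(x) = 1 }, where x = (u,i) ∈ L'(u) iff no F-out-neighbour
-- (v,j) of x (i.e. D u v and M u v i j) lies in S(v).
Sstep : ∀ {n k} → Digraph n → CrossEdges n k → VSet n k → Outcome n k → VSet n k
Sstep D M S ξ u i =
  ξ u i ∧ allFin? (λ v → not (D u v) ∨ allFin? (λ j → not (M u v i j) ∨ not (S v j)))

-- A rule ξ ↦ S(ξ) is "the" random set construction iff it satisfies the
-- defining recursive equations (unique for acyclic D).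
IsSConstruction : ∀ {n k} → Digraph n → CrossEdges n k → (Outcome n k → VSet n k) → Set
IsSConstruction D M S = ∀ ξ u i → S ξ u i ≡ Sstep D M (S ξ) ξ u i

allFuns : ∀ {A : Set} (m : ℕ) → List A → List (Fin m → A)
allFuns zero    xs = (λ ()) ∷ []
allFuns (suc m) xs =
  concatMap (λ a → map (λ f → λ { zero → a ; (suc i) → f i }) (allFuns m xs)) xs

allOutcomes : (n k : ℕ) → List (Outcome n k)
allOutcomes n k = allFuns n (allFuns k (true ∷ false ∷ []))

sumℚ : List ℚ → ℚ
sumℚ = foldr _+_ 0ℚ

prodℚ : List ℚ → ℚ
prodℚ = foldr _*_ 1ℚ

prodV : ∀ {n k} → (Fin n → Fin k → ℚ) → ℚ
prodV {n} {k} f = prodℚ (map (λ v → prodℚ (map (f v) (allFin k))) (allFin n))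

weight : ∀ {n k} → (Fin n → ℚ) → Outcome n k → ℚ
weight p ξ = prodV (λ v j → if ξ v j then p v else 1ℚ - p v)

Event : ℕ → ℕ → Set
Event n k = Outcome n k → Bool

Pr : ∀ {n k} → (Fin n → ℚ) → Event n k → ℚ
Pr {n} {k} p E = sumℚ (map (λ ξ → if E ξ then weight p ξ else 0ℚ) (allOutcomes n k))

_∩ᴱ_ : ∀ {n k} → Event n k → Event n k → Event n k
(E ∩ᴱ C) ξ = E ξ ∧ C ξ

CondPr : ∀ {n k} → (p : Fin n → ℚ) → Event n k → (C : Event n k) → 0ℚ < Pr p C → ℚ
CondPr p E C pos = Pr p (E ∩ᴱ C) * (1/ Pr p C) {{>-nonZero pos}}

EventSA : ∀ {n k} → (Outcome n k → VSet n k) → (Fin n → Bool) → VSet n k → Event n k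
EventSA S inA Q ξ = allFin? (λ a → not (inA a) ∨ allFin? (λ i → not (S ξ a i xor Q a i)))

EventNotIn : ∀ {n k} → (Outcome n k → VSet n k) → Fin n → Fin k → Event n k
EventNotIn S v j ξ = not (S ξ v j)

EventAvoid : ∀ {n k} → (Outcome n k → VSet n k) → VSet n k → Event n k
EventAvoid S Y ξ = allFin? (λ v → allFin? (λ j → not (Y v j) ∨ not (S ξ v j)))

prodOver : ∀ {n k} → VSet n k → (Fin n → Fin k → ℚ) → ℚ
prodOver Y f = prodV (λ v j → if Y v j then f v j else 1ℚ)

-- Since A is closed under out-arcs, the event S(A) = Q depends only on the bits ξ on L(A); on that
-- event the sets S(v), v ∉ A, are those computed with the bits on L(A) frozen at any outcome ξ₀ of the
-- event.  By independence, conditioning on S(A) = Q therefore amounts to evaluating S at the frozen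
-- outcome under the unconditioned product measure.  Order the bits of a vertex v reversed exactly when
-- v is reached from u by a walk of odd length.  As no arc has an even shortcut, all walks from u to a
-- vertex outside A have the same parity, so along every arc between such vertices the parity flips;
-- since S(w) = ξ(w) ∩ L′(w) is antitone in the sets S of the out-neighbours of w, the frozen S(w) is
-- increasing or decreasing in this order according to that parity.  Hence each event y ∉ S,
-- y ∈ L(N⁺(u)), is increasing, and Harris's inequality for the product measure on the bits (proved
-- coordinate by coordinate from the two-point Chebyshev inequality) gives the claim.
module Submission where

open import Defs
open import Data.Nat as ℕ using (ℕ; zero; suc; parity)
import Data.Nat.Properties as ℕ
open import Data.Fin using (Fin; zero; suc)
open import Data.Fin.Properties using (pigeonhole)
open import Data.Parity.Base as ℙ using (0ℙ; 1ℙ)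
open import Data.Parity.Properties using (+-homo-+; p+p≡0ℙ)
open import Data.Bool using (Bool; T; true; false; not; _∧_; _∨_; _xor_; if_then_else_)
open import Data.Bool.Properties using (T-∧; ∧-zeroʳ; ∧-identityʳ)
open import Data.Bool.ListAction using (all; and)
open import Data.List using (List; []; _∷_; map; concatMap; _++_)
open import Data.List.Base using (allFin)
open import Data.List.Properties using (map-++; map-∘; map-cong; map-tabulate)
import Data.List.Relation.Unary.All as All
open import Data.List.Relation.Unary.All.Properties using (all⁺; all⁻)
open import Data.List.Membership.Propositional.Properties using (∈-allFin)
open import Data.Product using (Σ; ∃; _×_; _,_; proj₁; proj₂)
open import Data.Sum using (_⊎_; inj₁; inj₂)
open import Data.Empty using (⊥-elim)
open import Data.Unit using (⊤; tt)
open import Function using (_∘_; id)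
open import Function.Bundles using (_⇔_; Equivalence)
open import Induction.WellFounded using (WellFounded; Acc; acc)
open import Relation.Nullary using (¬_; yes; no)
open import Relation.Nullary.Decidable using (T?; decidable-stable)
open import Relation.Binary.PropositionalEquality
open import Data.Rational using (ℚ; 0ℚ; 1ℚ; _≤_; _<_; _+_; _*_; _-_; -_; 1/_; nonNegative; >-nonZero)
open import Data.Rational.Properties
open import Data.Rational.Solver using (module +-*-Solver)

0≤1 : 0ℚ ≤ 1ℚ
0≤1 = nonNegative⁻¹ 1ℚ

*-nonNeg : ∀ {p q} → 0ℚ ≤ p → 0ℚ ≤ q → 0ℚ ≤ p * q
*-nonNeg {p} {q} 0≤p 0≤q =
  nonNegative⁻¹ (p * q) {{nonNeg*nonNeg⇒nonNeg p {{nonNegative 0≤p}} q {{nonNegative 0≤q}}}}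

*-mono-≤-nonNeg : ∀ {p q r s} → 0ℚ ≤ p → 0ℚ ≤ s → p ≤ q → r ≤ s → p * r ≤ q * s
*-mono-≤-nonNeg {p} {s = s} 0≤p 0≤s p≤q r≤s =
  ≤-trans (*-monoˡ-≤-nonNeg p {{nonNegative 0≤p}} r≤s) (*-monoʳ-≤-nonNeg s {{nonNegative 0≤s}} p≤q)

p≤q⇒0≤q-p : ∀ {p q} → p ≤ q → 0ℚ ≤ q - p
p≤q⇒0≤q-p {p} {q} p≤q = subst (_≤ q - p) (+-inverseʳ p) (+-monoˡ-≤ (- p) p≤q)

sumℚ-++ : ∀ (xs ys : List ℚ) → sumℚ (xs ++ ys) ≡ sumℚ xs + sumℚ ys
sumℚ-++ []       ys = sym (+-identityˡ (sumℚ ys))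
sumℚ-++ (x ∷ xs) ys = trans (cong (x +_) (sumℚ-++ xs ys)) (sym (+-assoc x (sumℚ xs) (sumℚ ys)))

module _ {I : Set} where

  prodℚ-nonNeg : ∀ (is : List I) {f : I → ℚ} → (∀ i → 0ℚ ≤ f i) → 0ℚ ≤ prodℚ (map f is)
  prodℚ-nonNeg []       f≥0 = 0≤1
  prodℚ-nonNeg (i ∷ is) f≥0 = *-nonNeg (f≥0 i) (prodℚ-nonNeg is f≥0)

  prodℚ-mono : ∀ (is : List I) {f g : I → ℚ} → (∀ i → 0ℚ ≤ f i) → (∀ i → f i ≤ g i) →
               prodℚ (map f is) ≤ prodℚ (map g is)
  prodℚ-mono []       f≥0 f≤g = ≤-refl
  prodℚ-mono (i ∷ is) f≥0 f≤g =
    *-mono-≤-nonNeg (f≥0 i) (prodℚ-nonNeg is (λ j → ≤-trans (f≥0 j) (f≤g j)))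
                    (f≤g i) (prodℚ-mono is f≥0 f≤g)

module _ {m : ℕ} {f : Fin m → Bool} where

  allFin?⁺ : T (allFin? f) → ∀ i → T (f i)
  allFin?⁺ t i = All.lookup (all⁺ f (allFin m) t) (∈-allFin i)

  allFin?⁻ : (∀ i → T (f i)) → T (allFin? f)
  allFin?⁻ t = all⁻ f {allFin m} (All.tabulate λ {i} _ → t i)

allFin?-cong : ∀ {m} {f g : Fin m → Bool} → (∀ i → f i ≡ g i) → allFin? f ≡ allFin? g
allFin?-cong {m} f≗g = cong and (map-cong f≗g (allFin m))

⇒-elim : ∀ a {b} → T (not a ∨ b) → T a → T b
⇒-elim true t _ = t

⇒-map : ∀ a {b c} → (T a → T b → T c) → T (not a ∨ b) → T (not a ∨ c)
⇒-map false _ _ = tt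
⇒-map true  f t = f tt t

⇒-congʳ : ∀ a {b c} → (T a → b ≡ c) → not a ∨ b ≡ not a ∨ c
⇒-congʳ false _  = refl
⇒-congʳ true  eq = eq tt

not-antitone : ∀ {a b} → (T b → T a) → T (not a) → T (not b)
not-antitone {false} {false} _   _ = tt
not-antitone {false} {true}  b⇒a _ = b⇒a tt

ind : Bool → ℚ
ind b = if b then 1ℚ else 0ℚ

ind-nonNeg : ∀ b → 0ℚ ≤ ind b
ind-nonNeg true  = 0≤1
ind-nonNeg false = ≤-refl

ind-mono : ∀ {a b} → (T a → T b) → ind a ≤ ind b
ind-mono {false} {b}     _   = ind-nonNeg b
ind-mono {true}  {true}  _   = ≤-refl
ind-mono {true}  {false} a⇒b = ⊥-elim (a⇒b tt)

ind-∧ : ∀ a b → ind (a ∧ b) ≡ ind a * ind b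
ind-∧ true  b = sym (*-identityˡ (ind b))
ind-∧ false b = sym (*-zeroˡ (ind b))

ind-∧-guard : ∀ a b {a′} → (T b → a ≡ a′) → ind (a ∧ b) ≡ ind b * ind a′
ind-∧-guard a false {a′} _    = trans (cong ind (∧-zeroʳ a)) (sym (*-zeroˡ (ind a′)))
ind-∧-guard a true  {a′} a≡a′ =
  trans (cong ind (trans (∧-identityʳ a) (a≡a′ tt))) (sym (*-identityˡ (ind a′)))

ind-all : ∀ {A : Set} (f : A → Bool) xs → ind (all f xs) ≡ prodℚ (map (ind ∘ f) xs)
ind-all f []       = refl
ind-all f (x ∷ xs) = trans (ind-∧ (f x) (all f xs)) (cong (ind (f x) *_) (ind-all f xs))

ind-allFin² : ∀ {m l} (f : Fin m → Fin l → Bool) →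
              ind (allFin? λ v → allFin? (f v))
                ≡ prodℚ (map (λ v → prodℚ (map (λ j → ind (f v j)) (allFin l))) (allFin m))
ind-allFin² {m} {l} f = trans (ind-all (λ v → allFin? (f v)) (allFin m))
                              (cong prodℚ (map-cong (λ v → ind-all (f v) (allFin l)) (allFin m)))

-- Weighted sums and finite product spaces

𝔼 : ∀ {X : Set} → List X → (X → ℚ) → (X → ℚ) → ℚ
𝔼 xs w f = sumℚ (map (λ x → w x * f x) xs)

module _ {X : Set} where

  𝔼-cong : ∀ xs w {f g : X → ℚ} → (∀ x → f x ≡ g x) → 𝔼 xs w f ≡ 𝔼 xs w g
  𝔼-cong xs w f≗g = cong sumℚ (map-cong (λ x → cong (w x *_) (f≗g x)) xs)

  𝔼-congʷ : ∀ xs {v w : X → ℚ} f → (∀ x → v x ≡ w x) → 𝔼 xs v f ≡ 𝔼 xs w f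
  𝔼-congʷ xs f v≗w = cong sumℚ (map-cong (λ x → cong (_* f x) (v≗w x)) xs)

  𝔼-mono : ∀ xs w {f g : X → ℚ} → (∀ x → 0ℚ ≤ w x) → (∀ x → f x ≤ g x) → 𝔼 xs w f ≤ 𝔼 xs w g
  𝔼-mono []       w w≥0 f≤g = ≤-refl
  𝔼-mono (x ∷ xs) w w≥0 f≤g =
    +-mono-≤ (*-monoˡ-≤-nonNeg (w x) {{nonNegative (w≥0 x)}} (f≤g x)) (𝔼-mono xs w w≥0 f≤g)

  𝔼-nonNeg : ∀ xs w {f : X → ℚ} → (∀ x → 0ℚ ≤ w x) → (∀ x → 0ℚ ≤ f x) → 0ℚ ≤ 𝔼 xs w f
  𝔼-nonNeg []       w w≥0 f≥0 = ≤-refl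
  𝔼-nonNeg (x ∷ xs) w w≥0 f≥0 = +-mono-≤ (*-nonNeg (w≥0 x) (f≥0 x)) (𝔼-nonNeg xs w w≥0 f≥0)

  𝔼-*ʳ : ∀ xs w (f : X → ℚ) c → 𝔼 xs w (λ x → f x * c) ≡ 𝔼 xs w f * c
  𝔼-*ʳ []       w f c = sym (*-zeroˡ c)
  𝔼-*ʳ (x ∷ xs) w f c = begin
    w x * (f x * c) + 𝔼 xs w (λ y → f y * c) ≡⟨ cong₂ _+_ (sym (*-assoc (w x) (f x) c)) (𝔼-*ʳ xs w f c) ⟩
    w x * f x * c + 𝔼 xs w f * c            ≡⟨ *-distribʳ-+ c (w x * f x) (𝔼 xs w f) ⟨
    (w x * f x + 𝔼 xs w f) * c              ∎
    where open ≡-Reasoning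

  𝔼-*ʷ : ∀ xs c (w f : X → ℚ) → 𝔼 xs (λ x → c * w x) f ≡ c * 𝔼 xs w f
  𝔼-*ʷ []       c w f = sym (*-zeroʳ c)
  𝔼-*ʷ (x ∷ xs) c w f = begin
    c * w x * f x + 𝔼 xs (λ y → c * w y) f ≡⟨ cong₂ _+_ (*-assoc c (w x) (f x)) (𝔼-*ʷ xs c w f) ⟩
    c * (w x * f x) + c * 𝔼 xs w f         ≡⟨ *-distribˡ-+ c (w x * f x) (𝔼 xs w f) ⟨
    c * (w x * f x + 𝔼 xs w f)             ∎
    where open ≡-Reasoning

  𝔼-singleton : ∀ x w (f : X → ℚ) → 𝔼 (x ∷ []) w f ≡ w x * f x
  𝔼-singleton x w f = +-identityʳ (w x * f x)

  𝔼-map : ∀ {A : Set} (g : A → X) as w f → 𝔼 (map g as) w f ≡ 𝔼 as (w ∘ g) (f ∘ g)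
  𝔼-map g as w f = cong sumℚ (sym (map-∘ {g = λ x → w x * f x} {f = g} as))

  𝔼-concatMap : ∀ {A : Set} (as : List A) (xs : A → List X) w f →
                𝔼 (concatMap xs as) w f ≡ sumℚ (map (λ a → 𝔼 (xs a) w f) as)
  𝔼-concatMap []       xs w f = refl
  𝔼-concatMap (a ∷ as) xs w f = begin
    sumℚ (map (λ x → w x * f x) (xs a ++ concatMap xs as))
      ≡⟨ cong sumℚ (map-++ (λ x → w x * f x) (xs a) (concatMap xs as)) ⟩
    sumℚ (map (λ x → w x * f x) (xs a) ++ map (λ x → w x * f x) (concatMap xs as))
      ≡⟨ sumℚ-++ (map (λ x → w x * f x) (xs a)) _ ⟩
    𝔼 (xs a) w f + 𝔼 (concatMap xs as) w f
      ≡⟨ cong (𝔼 (xs a) w f +_) (𝔼-concatMap as xs w f) ⟩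
    𝔼 (xs a) w f + sumℚ (map (λ b → 𝔼 (xs b) w f) as) ∎
    where open ≡-Reasoning

  𝔼-factor : ∀ xs w (f g : X → ℚ) → 𝔼 xs w (λ _ → 1ℚ) ≡ 1ℚ → (∀ x y → g x ≡ g y) →
             𝔼 xs w (λ x → f x * g x) ≡ 𝔼 xs w f * 𝔼 xs w g
  𝔼-factor []       w f g mass1 g-const = sym (*-zeroˡ 0ℚ)
  𝔼-factor (x ∷ xs) w f g mass1 g-const = begin
    𝔼 (x ∷ xs) w (λ y → f y * g y)   ≡⟨ 𝔼-cong (x ∷ xs) w (λ y → cong (f y *_) (g-const y x)) ⟩
    𝔼 (x ∷ xs) w (λ y → f y * g x)   ≡⟨ 𝔼-*ʳ (x ∷ xs) w f (g x) ⟩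
    𝔼 (x ∷ xs) w f * g x             ≡⟨ cong (𝔼 (x ∷ xs) w f *_) 𝔼g≡gx ⟨
    𝔼 (x ∷ xs) w f * 𝔼 (x ∷ xs) w g  ∎
    where
    open ≡-Reasoning
    𝔼g≡gx : 𝔼 (x ∷ xs) w g ≡ g x
    𝔼g≡gx = begin
      𝔼 (x ∷ xs) w g                 ≡⟨ 𝔼-cong (x ∷ xs) w (λ y → trans (g-const y x) (sym (*-identityˡ (g x)))) ⟩
      𝔼 (x ∷ xs) w (λ _ → 1ℚ * g x)  ≡⟨ 𝔼-*ʳ (x ∷ xs) w (λ _ → 1ℚ) (g x) ⟩
      𝔼 (x ∷ xs) w (λ _ → 1ℚ) * g x  ≡⟨ cong (_* g x) mass1 ⟩
      1ℚ * g x                       ≡⟨ *-identityˡ (g x) ⟩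
      g x                            ∎

map-allFin-suc : ∀ {A : Set} m (f : Fin (suc m) → A) → map f (allFin (suc m)) ≡ f zero ∷ map (f ∘ suc) (allFin m)
map-allFin-suc m f = cong (f zero ∷_) (trans (map-tabulate suc f) (sym (map-tabulate id (f ∘ suc))))

module _ {X : Set} where

  weightΠ : ∀ m → (Fin m → X → ℚ) → (Fin m → X) → ℚ
  weightΠ m ws r = prodℚ (map (λ i → ws i (r i)) (allFin m))

  weightΠ-nonNeg : ∀ m ws → (∀ i x → 0ℚ ≤ ws i x) → ∀ r → 0ℚ ≤ weightΠ m ws r
  weightΠ-nonNeg m ws ws≥0 r = prodℚ-nonNeg (allFin m) (λ i → ws≥0 i (r i))

  𝔼Π : List X → ∀ m → (Fin m → X → ℚ) → ((Fin m → X) → ℚ) → ℚ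
  𝔼Π xs m ws = 𝔼 (allFuns m xs) (weightΠ m ws)

  -- allFuns conses a coordinate onto a tuple with a pattern lambda that cannot be referred to by
  -- name; the Σ-type extracts it, so that consᶠ computes on zero and suc.
  allFuns-suc : ∀ m (xs : List X) → Σ (X → (Fin m → X) → Fin (suc m) → X) λ cons →
                allFuns (suc m) xs ≡ concatMap (λ a → map (cons a) (allFuns m xs)) xs
  allFuns-suc m xs = _ , refl

  consᶠ : ∀ {m} (xs : List X) → X → (Fin m → X) → Fin (suc m) → X
  consᶠ {m} xs = proj₁ (allFuns-suc m xs)

  weightΠ-suc : ∀ m (xs : List X) ws a r → weightΠ (suc m) ws (consᶠ xs a r) ≡ ws zero a * weightΠ m (ws ∘ suc) r
  weightΠ-suc m xs ws a r = cong prodℚ (map-allFin-suc m (λ i → ws i (consᶠ xs a r i)))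

  𝔼Π-zero : ∀ xs ws (h : (Fin 0 → X) → ℚ) → 𝔼Π xs 0 ws h ≡ h (λ ())
  𝔼Π-zero xs ws h = trans (𝔼-singleton (λ ()) (weightΠ 0 ws) h) (*-identityˡ (h (λ ())))

  𝔼Π-suc : ∀ xs m ws h → 𝔼Π xs (suc m) ws h ≡ 𝔼 xs (ws zero) (λ a → 𝔼Π xs m (ws ∘ suc) (h ∘ consᶠ xs a))
  𝔼Π-suc xs m ws h =
    trans (𝔼-concatMap xs _ (weightΠ (suc m) ws) h) (cong sumℚ (map-cong first-coordinate xs))
    where
    first-coordinate : ∀ a → 𝔼 (map (consᶠ xs a) (allFuns m xs)) (weightΠ (suc m) ws) h
                           ≡ ws zero a * 𝔼Π xs m (ws ∘ suc) (h ∘ consᶠ xs a)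
    first-coordinate a = begin
      𝔼 (map (consᶠ xs a) (allFuns m xs)) (weightΠ (suc m) ws) h
        ≡⟨ 𝔼-map (consᶠ xs a) (allFuns m xs) (weightΠ (suc m) ws) h ⟩
      𝔼 (allFuns m xs) (weightΠ (suc m) ws ∘ consᶠ xs a) (h ∘ consᶠ xs a)
        ≡⟨ 𝔼-congʷ (allFuns m xs) (h ∘ consᶠ xs a) (weightΠ-suc m xs ws a) ⟩
      𝔼 (allFuns m xs) (λ r → ws zero a * weightΠ m (ws ∘ suc) r) (h ∘ consᶠ xs a)
        ≡⟨ 𝔼-*ʷ (allFuns m xs) (ws zero a) (weightΠ m (ws ∘ suc)) (h ∘ consᶠ xs a) ⟩
      ws zero a * 𝔼Π xs m (ws ∘ suc) (h ∘ consᶠ xs a) ∎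
      where open ≡-Reasoning

  𝔼Π-mass : ∀ xs m ws → (∀ i → 𝔼 xs (ws i) (λ _ → 1ℚ) ≡ 1ℚ) → 𝔼Π xs m ws (λ _ → 1ℚ) ≡ 1ℚ
  𝔼Π-mass xs zero    ws mass1 = 𝔼Π-zero xs ws (λ _ → 1ℚ)
  𝔼Π-mass xs (suc m) ws mass1 = begin
    𝔼Π xs (suc m) ws (λ _ → 1ℚ)
      ≡⟨ 𝔼Π-suc xs m ws (λ _ → 1ℚ) ⟩
    𝔼 xs (ws zero) (λ _ → 𝔼Π xs m (ws ∘ suc) (λ _ → 1ℚ))
      ≡⟨ 𝔼-cong xs (ws zero) (λ _ → 𝔼Π-mass xs m (ws ∘ suc) (mass1 ∘ suc)) ⟩
    𝔼 xs (ws zero) (λ _ → 1ℚ)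
      ≡⟨ mass1 zero ⟩
    1ℚ ∎
    where open ≡-Reasoning

  DependsOnly : ∀ {m} → (X → X → Set) → (Fin m → Set) → ((Fin m → X) → ℚ) → Set
  DependsOnly _≈_ C h = ∀ r r' → (∀ i → C i → r i ≈ r' i) → h r ≡ h r'

  𝔼Π-indep : ∀ xs (_≈_ : X → X → Set) → (∀ a → a ≈ a) →
             ∀ m ws (c : Fin m → Bool) (f g : (Fin m → X) → ℚ) →
             (∀ i → 𝔼 xs (ws i) (λ _ → 1ℚ) ≡ 1ℚ) →
             DependsOnly _≈_ (T ∘ c) f → DependsOnly _≈_ (λ i → ¬ T (c i)) g →
             𝔼Π xs m ws (λ r → f r * g r) ≡ 𝔼Π xs m ws f * 𝔼Π xs m ws g
  𝔼Π-indep xs _≈_ ≈-refl zero ws c f g mass1 f-dep g-dep =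
    trans (𝔼Π-zero xs ws (λ r → f r * g r)) (sym (cong₂ _*_ (𝔼Π-zero xs ws f) (𝔼Π-zero xs ws g)))
  𝔼Π-indep xs _≈_ ≈-refl (suc m) ws c f g mass1 f-dep g-dep = begin
    𝔼Π xs (suc m) ws (λ r → f r * g r)
      ≡⟨ 𝔼Π-suc xs m ws (λ r → f r * g r) ⟩
    𝔼 xs (ws zero) (λ a → 𝔼Π xs m ws′ (λ r → f (a ◂ r) * g (a ◂ r)))
      ≡⟨ 𝔼-cong xs (ws zero) (λ a →
           𝔼Π-indep xs _≈_ ≈-refl m ws′ (c ∘ suc) (f ∘ (a ◂_)) (g ∘ (a ◂_)) (mass1 ∘ suc)
             (λ r r' → f-dep _ _ ∘ extend a) (λ r r' → g-dep _ _ ∘ extend a)) ⟩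
    𝔼 xs (ws zero) (λ a → F a * G a)
      ≡⟨ factor-first-coordinate ⟩
    𝔼 xs (ws zero) F * 𝔼 xs (ws zero) G
      ≡⟨ cong₂ _*_ (𝔼Π-suc xs m ws f) (𝔼Π-suc xs m ws g) ⟨
    𝔼Π xs (suc m) ws f * 𝔼Π xs (suc m) ws g ∎
    where
    open ≡-Reasoning
    ws′ = ws ∘ suc
    _◂_ : X → (Fin m → X) → Fin (suc m) → X
    _◂_ = consᶠ xs
    F G : X → ℚ
    F a = 𝔼Π xs m ws′ (f ∘ (a ◂_))
    G a = 𝔼Π xs m ws′ (g ∘ (a ◂_))
    extend : ∀ {C : Fin (suc m) → Set} a {r r'} → (∀ i → C (suc i) → r i ≈ r' i) →
             ∀ i → C i → (a ◂ r) i ≈ (a ◂ r') i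
    extend a r≈r' zero    _  = ≈-refl a
    extend a r≈r' (suc i) ci = r≈r' i ci
    vary-first : ∀ {C : Fin (suc m) → Set} a b → ¬ C zero →
                 ∀ (r : Fin m → X) i → C i → (a ◂ r) i ≈ (b ◂ r) i
    vary-first a b ¬c0 r zero    c0 = ⊥-elim (¬c0 c0)
    vary-first a b ¬c0 r (suc i) _  = ≈-refl (r i)
    factor-first-coordinate : 𝔼 xs (ws zero) (λ a → F a * G a) ≡ 𝔼 xs (ws zero) F * 𝔼 xs (ws zero) G
    factor-first-coordinate with T? (c zero)
    ... | yes c0 = 𝔼-factor xs (ws zero) F G (mass1 zero) λ a b →
                     𝔼-cong (allFuns m xs) (weightΠ m ws′) (λ r → g-dep _ _ (vary-first a b (λ ¬c0 → ¬c0 c0) r))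
    ... | no ¬c0 = begin
      𝔼 xs (ws zero) (λ a → F a * G a)
        ≡⟨ 𝔼-cong xs (ws zero) (λ a → *-comm (F a) (G a)) ⟩
      𝔼 xs (ws zero) (λ a → G a * F a)
        ≡⟨ 𝔼-factor xs (ws zero) G F (mass1 zero) (λ a b →
             𝔼-cong (allFuns m xs) (weightΠ m ws′) (λ r → f-dep _ _ (vary-first a b ¬c0 r))) ⟩
      𝔼 xs (ws zero) G * 𝔼 xs (ws zero) F
        ≡⟨ *-comm (𝔼 xs (ws zero) G) (𝔼 xs (ws zero) F) ⟩
      𝔼 xs (ws zero) F * 𝔼 xs (ws zero) G ∎

-- Harris's inequality

Monotone : ∀ {X : Set} → (X → X → Set) → (X → ℚ) → Set
Monotone _≼_ f = ∀ {x y} → x ≼ y → f x ≤ f y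

Harris : ∀ {X : Set} → List X → (X → ℚ) → (X → X → Set) → Set
Harris xs w _≼_ = ∀ f g → Monotone _≼_ f → Monotone _≼_ g → 𝔼 xs w f * 𝔼 xs w g ≤ 𝔼 xs w (λ x → f x * g x)

Pointwise : ∀ {X : Set} {m} → (Fin m → X → X → Set) → (Fin m → X) → (Fin m → X) → Set
Pointwise R r r' = ∀ i → R i (r i) (r' i)

harrisΠ : ∀ {X : Set} (xs : List X) m ws (R : Fin m → X → X → Set) →
          (∀ i x → 0ℚ ≤ ws i x) → (∀ i x → R i x x) → (∀ i → Harris xs (ws i) (R i)) →
          Harris (allFuns m xs) (weightΠ m ws) (Pointwise R)
harrisΠ xs zero    ws R ws≥0 R-refl harris f g f↑ g↑ =
  ≤-reflexive (trans (cong₂ _*_ (𝔼Π-zero xs ws f) (𝔼Π-zero xs ws g)) (sym (𝔼Π-zero xs ws (λ r → f r * g r))))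
harrisΠ {X} xs (suc m) ws R ws≥0 R-refl harris f g f↑ g↑ = begin
  𝔼Π xs (suc m) ws f * 𝔼Π xs (suc m) ws g
    ≡⟨ cong₂ _*_ (𝔼Π-suc xs m ws f) (𝔼Π-suc xs m ws g) ⟩
  𝔼 xs (ws zero) (marginal f) * 𝔼 xs (ws zero) (marginal g)
    ≤⟨ harris zero (marginal f) (marginal g) (marginal-mono f↑) (marginal-mono g↑) ⟩
  𝔼 xs (ws zero) (λ a → marginal f a * marginal g a)
    ≤⟨ 𝔼-mono xs (ws zero) (ws≥0 zero) (λ a →
         harrisΠ xs m ws′ (R ∘ suc) (ws≥0 ∘ suc) (R-refl ∘ suc) (harris ∘ suc) (f ∘ (a ◂_)) (g ∘ (a ◂_))
           (f↑ ∘ extend a) (g↑ ∘ extend a)) ⟩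
  𝔼 xs (ws zero) (λ a → 𝔼Π xs m ws′ (λ r → f (a ◂ r) * g (a ◂ r)))
    ≡⟨ 𝔼Π-suc xs m ws (λ r → f r * g r) ⟨
  𝔼Π xs (suc m) ws (λ r → f r * g r) ∎
  where
  open ≤-Reasoning
  ws′ = ws ∘ suc
  _◂_ : X → (Fin m → X) → Fin (suc m) → X
  _◂_ = consᶠ xs
  marginal : ((Fin (suc m) → X) → ℚ) → X → ℚ
  marginal h a = 𝔼Π xs m ws′ (h ∘ (a ◂_))
  extend : ∀ a {r r'} → Pointwise (R ∘ suc) r r' → Pointwise R (a ◂ r) (a ◂ r')
  extend a r≼r' zero    = R-refl zero a
  extend a r≼r' (suc i) = r≼r' i
  marginal-mono : ∀ {h} → Monotone (Pointwise R) h → Monotone (R zero) (marginal h)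
  marginal-mono {h} h↑ {a} {b} a≼b = 𝔼-mono (allFuns m xs) (weightΠ m ws′) (weightΠ-nonNeg m ws′ (ws≥0 ∘ suc))
    (λ r → h↑ λ { zero → a≼b ; (suc i) → R-refl (suc i) (r i) })

prodᶠ : ∀ {I X : Set} → List I → (I → X → ℚ) → X → ℚ
prodᶠ is g x = prodℚ (map (λ i → g i x) is)

prodᶠ-nonNeg : ∀ {I X : Set} (is : List I) (g : I → X → ℚ) → (∀ i x → 0ℚ ≤ g i x) → ∀ x → 0ℚ ≤ prodᶠ is g x
prodᶠ-nonNeg is g g≥0 x = prodℚ-nonNeg is (λ i → g≥0 i x)

prodᶠ-mono : ∀ {I X : Set} {_≼_ : X → X → Set} (is : List I) (g : I → X → ℚ) →
             (∀ i x → 0ℚ ≤ g i x) → (∀ i → Monotone _≼_ (g i)) → Monotone _≼_ (prodᶠ is g)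
prodᶠ-mono []       g g≥0 g↑ x≼y = ≤-refl
prodᶠ-mono (i ∷ is) g g≥0 g↑ {x} {y} x≼y =
  *-mono-≤-nonNeg (g≥0 i x) (prodᶠ-nonNeg is g g≥0 y) (g↑ i x≼y) (prodᶠ-mono is g g≥0 g↑ x≼y)

module _ {X : Set} (xs : List X) (w : X → ℚ) (_≼_ : X → X → Set)
         (w≥0 : ∀ x → 0ℚ ≤ w x) (mass1 : 𝔼 xs w (λ _ → 1ℚ) ≡ 1ℚ) (harris : Harris xs w _≼_) where

  harris-prod : ∀ {I : Set} (is : List I) (g : I → X → ℚ) →
                (∀ i x → 0ℚ ≤ g i x) → (∀ i → Monotone _≼_ (g i)) →
                prodℚ (map (λ i → 𝔼 xs w (g i)) is) ≤ 𝔼 xs w (prodᶠ is g)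
  harris-prod []       g g≥0 g↑ = ≤-reflexive (sym mass1)
  harris-prod (i ∷ is) g g≥0 g↑ = begin
    𝔼 xs w (g i) * prodℚ (map (λ j → 𝔼 xs w (g j)) is)
      ≤⟨ *-monoˡ-≤-nonNeg (𝔼 xs w (g i)) {{nonNegative (𝔼-nonNeg xs w w≥0 (g≥0 i))}} (harris-prod is g g≥0 g↑) ⟩
    𝔼 xs w (g i) * 𝔼 xs w (prodᶠ is g)
      ≤⟨ harris (g i) (prodᶠ is g) (g↑ i) (prodᶠ-mono is g g≥0 g↑) ⟩
    𝔼 xs w (prodᶠ (i ∷ is) g) ∎
    where open ≤-Reasoning

  harris-prod² : ∀ {I J : Set} (is : List I) (js : List J) (g : I → J → X → ℚ) →
                 (∀ i j x → 0ℚ ≤ g i j x) → (∀ i j → Monotone _≼_ (g i j)) →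
                 prodℚ (map (λ i → prodℚ (map (λ j → 𝔼 xs w (g i j)) js)) is)
                   ≤ 𝔼 xs w (prodᶠ is (λ i → prodᶠ js (g i)))
  harris-prod² is js g g≥0 g↑ = begin
    prodℚ (map (λ i → prodℚ (map (λ j → 𝔼 xs w (g i j)) js)) is)
      ≤⟨ prodℚ-mono is (λ i → prodℚ-nonNeg js (λ j → 𝔼-nonNeg xs w w≥0 (g≥0 i j)))
                       (λ i → harris-prod js (g i) (g≥0 i) (g↑ i)) ⟩
    prodℚ (map (λ i → 𝔼 xs w (prodᶠ js (g i))) is)
      ≤⟨ harris-prod is (λ i → prodᶠ js (g i)) (λ i → prodᶠ-nonNeg js (g i) (g≥0 i))
                     (λ i → prodᶠ-mono js (g i) (g≥0 i) (g↑ i)) ⟩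
    𝔼 xs w (prodᶠ is (λ i → prodᶠ js (g i))) ∎
    where open ≤-Reasoning

bits : List Bool
bits = true ∷ false ∷ []

bitWeight : ℚ → Bool → ℚ
bitWeight q b = if b then q else 1ℚ - q

module _ where
  open +-*-Solver

  bit-mass : ∀ q → 𝔼 bits (bitWeight q) (λ _ → 1ℚ) ≡ 1ℚ
  bit-mass = solve 1 (λ q → q :* con 1ℚ :+ ((con 1ℚ :- q) :* con 1ℚ :+ con 0ℚ) := con 1ℚ) refl

  bit-covariance : ∀ q f g → 𝔼 bits (bitWeight q) f * 𝔼 bits (bitWeight q) g
                               + q * (1ℚ - q) * ((f true - f false) * (g true - g false))
                             ≡ 𝔼 bits (bitWeight q) (λ b → f b * g b)
  bit-covariance q f g = solve 5 (λ q a b c d →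
      (q :* a :+ ((con 1ℚ :- q) :* b :+ con 0ℚ)) :* (q :* c :+ ((con 1ℚ :- q) :* d :+ con 0ℚ))
        :+ q :* (con 1ℚ :- q) :* ((a :- b) :* (c :- d))
      := q :* (a :* c) :+ ((con 1ℚ :- q) :* (b :* d) :+ con 0ℚ))
    refl q (f true) (f false) (g true) (g false)

  [p-q]*[r-s]≡[q-p]*[s-r] : ∀ p q r s → (p - q) * (r - s) ≡ (q - p) * (s - r)
  [p-q]*[r-s]≡[q-p]*[s-r] = solve 4 (λ p q r s → (p :- q) :* (r :- s) := (q :- p) :* (s :- r)) refl

harris-bit : ∀ {q} (R : Bool → Bool → Set) → 0ℚ ≤ q → q ≤ 1ℚ → ¬ ¬ (R true false ⊎ R false true) →
             Harris bits (bitWeight q) R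
harris-bit {q} R 0≤q q≤1 R-total f g f↑ g↑ = decidable-stable (_ ≤? _) λ ≰ → R-total λ R-tf⊎R-ft →
  ≰ (subst₂ _≤_ (+-identityʳ _) (bit-covariance q f g)
       (+-monoʳ-≤ (𝔼 bits (bitWeight q) f * 𝔼 bits (bitWeight q) g)
         (*-nonNeg (*-nonNeg 0≤q (p≤q⇒0≤q-p q≤1)) (comonotone R-tf⊎R-ft))))
  where
  comonotone : R true false ⊎ R false true → 0ℚ ≤ (f true - f false) * (g true - g false)
  comonotone (inj₁ R-tf) = subst (0ℚ ≤_) (sym ([p-q]*[r-s]≡[q-p]*[s-r] (f true) (f false) (g true) (g false)))
                             (*-nonNeg (p≤q⇒0≤q-p (f↑ R-tf)) (p≤q⇒0≤q-p (g↑ R-tf)))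
  comonotone (inj₂ R-ft) = *-nonNeg (p≤q⇒0≤q-p (f↑ R-ft)) (p≤q⇒0≤q-p (g↑ R-ft))

-- The probability space of outcomes

Pr-witness : ∀ {n k} p (E : Event n k) → 0ℚ < Pr p E → ∃ λ ξ → T (E ξ)
Pr-witness {n} {k} p E = search (allOutcomes n k)
  where
  search : ∀ ξs → 0ℚ < sumℚ (map (λ ξ → if E ξ then weight p ξ else 0ℚ) ξs) → ∃ λ ξ → T (E ξ)
  search []       0<0 = ⊥-elim (<-irrefl refl 0<0)
  search (ξ ∷ ξs) 0<Σ with E ξ in Eξ
  ... | true  = ξ , subst T (sym Eξ) tt
  ... | false = search ξs (subst (0ℚ <_) (+-identityˡ _) 0<Σ)

Pr∩≡Pr*x⇒CondPr≡x : ∀ {n k} p (E C : Event n k) (pos : 0ℚ < Pr p C) {x} →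
                    Pr p (E ∩ᴱ C) ≡ Pr p C * x → CondPr p E C pos ≡ x
Pr∩≡Pr*x⇒CondPr≡x p E C pos {x} eq = begin
  Pr p (E ∩ᴱ C) * 1/ Pr p C  ≡⟨ cong (_* 1/ Pr p C) (trans eq (*-comm (Pr p C) x)) ⟩
  x * Pr p C * 1/ Pr p C     ≡⟨ *-assoc x (Pr p C) (1/ Pr p C) ⟩
  x * (Pr p C * 1/ Pr p C)   ≡⟨ cong (x *_) (*-inverseʳ (Pr p C)) ⟩
  x * 1ℚ                     ≡⟨ *-identityʳ x ⟩
  x                          ∎
  where
  open ≡-Reasoning
  instance _ = >-nonZero pos

module OutcomeSpace {n k : ℕ} (p : Fin n → ℚ) (p∈[0,1] : ∀ v → 0ℚ ≤ p v × p v ≤ 1ℚ) where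

  vertexWeight : Fin n → (Fin k → Bool) → ℚ
  vertexWeight v = weightΠ k (λ _ → bitWeight (p v))

  𝔼Ω : (Outcome n k → ℚ) → ℚ
  𝔼Ω = 𝔼Π (allFuns k bits) n vertexWeight

  Pr≡𝔼Ω : ∀ E → Pr p E ≡ 𝔼Ω (ind ∘ E)
  Pr≡𝔼Ω E = cong sumℚ (map-cong (λ ξ → if-weight (E ξ) (weight p ξ)) (allOutcomes n k))
    where
    if-weight : ∀ b w → (if b then w else 0ℚ) ≡ w * ind b
    if-weight true  w = sym (*-identityʳ w)
    if-weight false w = sym (*-zeroʳ w)

  bitWeight-nonNeg : ∀ v b → 0ℚ ≤ bitWeight (p v) b
  bitWeight-nonNeg v true  = proj₁ (p∈[0,1] v)
  bitWeight-nonNeg v false = p≤q⇒0≤q-p (proj₂ (p∈[0,1] v))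

  vertexWeight-nonNeg : ∀ v bs → 0ℚ ≤ vertexWeight v bs
  vertexWeight-nonNeg v = weightΠ-nonNeg k (λ _ → bitWeight (p v)) (λ _ → bitWeight-nonNeg v)

  weight-nonNeg : ∀ ξ → 0ℚ ≤ weight p ξ
  weight-nonNeg = weightΠ-nonNeg n vertexWeight vertexWeight-nonNeg

  vertex-mass : ∀ v → 𝔼 (allFuns k bits) (vertexWeight v) (λ _ → 1ℚ) ≡ 1ℚ
  vertex-mass v = 𝔼Π-mass bits k (λ _ → bitWeight (p v)) (λ _ → bit-mass (p v))

  𝔼Ω-mass : 𝔼Ω (λ _ → 1ℚ) ≡ 1ℚ
  𝔼Ω-mass = 𝔼Π-mass (allFuns k bits) n vertexWeight vertex-mass

  𝔼Ω-indep : ∀ (inC : Fin n → Bool) (f g : Outcome n k → ℚ) →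
             DependsOnly _≗_ (T ∘ inC) f → DependsOnly _≗_ (λ v → ¬ T (inC v)) g →
             𝔼Ω (λ ξ → f ξ * g ξ) ≡ 𝔼Ω f * 𝔼Ω g
  𝔼Ω-indep inC f g = 𝔼Π-indep (allFuns k bits) _≗_ (λ _ _ → refl) n vertexWeight inC f g vertex-mass

  harrisΩ : (R : Fin n → Bool → Bool → Set) →
            (∀ v b → R v b b) → (∀ v → ¬ ¬ (R v true false ⊎ R v false true)) →
            Harris (allOutcomes n k) (weight p) (Pointwise (λ v → Pointwise (λ _ → R v)))
  harrisΩ R R-refl R-total =
    harrisΠ (allFuns k bits) n vertexWeight _ vertexWeight-nonNeg (λ v bs j → R-refl v (bs j)) λ v →
      harrisΠ bits k (λ _ → bitWeight (p v)) (λ _ → R v) (λ _ → bitWeight-nonNeg v) (λ _ → R-refl v) λ _ →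
        harris-bit (R v) (proj₁ (p∈[0,1] v)) (proj₂ (p∈[0,1] v)) (R-total v)

-- Walks and parity

module _ {n : ℕ} {D : Digraph n} where

  _++ʷ_ : ∀ {x y z a b} → Walk D x y a → Walk D y z b → Walk D x z (a ℕ.+ b)
  here     ++ʷ q = q
  step e p ++ʷ q = step e (p ++ʷ q)

  _▷_ : ∀ {x y z ℓ} → Walk D x y ℓ → T (D y z) → Walk D x z (ℓ ℕ.+ 1)
  p ▷ e = p ++ʷ step e here

  R⁻[]⇒Walk : ∀ {w v} → R⁻[ D ] w v → ∃ λ m → Walk D v w m
  R⁻[]⇒Walk (inj₁ refl)    = 0 , here
  R⁻[]⇒Walk (inj₂ (ℓ , q)) = suc ℓ , q

  vertexAt : ∀ {x y ℓ} → Walk D x y ℓ → Fin (suc ℓ) → Fin n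
  vertexAt {x} p          zero    = x
  vertexAt     (step e p) (suc i) = vertexAt p i

  walk-to : ∀ {x y ℓ} (p : Walk D x y ℓ) i → ∃ λ ℓ′ → Walk D x (vertexAt p i) ℓ′
  walk-to p          zero    = 0 , here
  walk-to (step e p) (suc i) with ℓ′ , q ← walk-to p i = suc ℓ′ , step e q

  walk-between : ∀ {x y ℓ} (p : Walk D x y ℓ) i j → Data.Fin._<_ i j →
                 ∃ λ ℓ′ → Walk D (vertexAt p i) (vertexAt p j) (suc ℓ′)
  walk-between (step e p) zero    (suc j) _           with ℓ′ , q ← walk-to p j = ℓ′ , step e q
  walk-between (step e p) (suc i) (suc j) (ℕ.s≤s i<j) = walk-between p i j i<j

  module _ (acyclic : Acyclic D) where

    acyclic⇒no-walk-of-length-n : ∀ {x y} → ¬ Walk D x y n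
    acyclic⇒no-walk-of-length-n p with i , j , i<j , same ← pigeonhole (ℕ.n<1+n n) (vertexAt p)
                                   with ℓ′ , cycle ← walk-between p i j i<j
      = acyclic (vertexAt p j) ℓ′ (subst (λ x → Walk D x (vertexAt p j) (suc ℓ′)) same cycle)

    acyclic⇒wellFounded : WellFounded (λ w v → T (D v w))
    acyclic⇒wellFounded v = bounded n v (λ _ → acyclic⇒no-walk-of-length-n)
      where
      bounded : ∀ b v → (∀ y → ¬ Walk D v y b) → Acc (λ w v → T (D v w)) v
      bounded zero    v no-walk = ⊥-elim (no-walk v here)
      bounded (suc b) v no-walk = acc λ e → bounded b _ (λ y p → no-walk y (step e p))

parity≡0ℙ⇒Even : ∀ ℓ → parity ℓ ≡ 0ℙ → Even ℓ
parity≡0ℙ⇒Even zero          _  = even0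
parity≡0ℙ⇒Even (suc zero)     ()
parity≡0ℙ⇒Even (suc (suc ℓ)) eq = even+2 (parity≡0ℙ⇒Even ℓ eq)

same-parity⇒Even-+ : ∀ a b → parity a ≡ parity b → Even (a ℕ.+ b)
same-parity⇒Even-+ a b eq =
  parity≡0ℙ⇒Even (a ℕ.+ b) (trans (+-homo-+ a b) (trans (cong (ℙ._+ parity b) eq) (p+p≡0ℙ (parity b))))

_≼[_]_ : Bool → Set → Bool → Set
a ≼[ P ] b = (P → T b → T a) × (¬ P → T a → T b)

≼-refl : ∀ {P} b → b ≼[ P ] b
≼-refl b = (λ _ t → t) , (λ _ t → t)

≼-total : ∀ {P} → ¬ ¬ (true ≼[ P ] false ⊎ false ≼[ P ] true)
≼-total ¬total = ¬total (inj₂ ((λ p _ → ¬total (inj₁ ((λ _ ()) , λ ¬p _ → ¬p p))) , λ _ ()))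

-- The random construction

module Construction {n k : ℕ} (D : Digraph n) (M : CrossEdges n k) (acyclic : Acyclic D)
                    (S : Outcome n k → VSet n k) (S-rec : IsSConstruction D M S) where

  -- Sstep D M σ ξ w i is definitionally ξ w i ∧ L′ σ w i, with L′ σ w the set L′(w) of the paper.
  L′ : VSet n k → Fin n → Fin k → Bool
  L′ σ w i = allFin? (λ v → not (D w v) ∨ allFin? (λ j → not (M w v i j) ∨ not (σ v j)))

  L′-cong : ∀ {σ σ'} w i → (∀ {v} → T (D w v) → σ v ≗ σ' v) → L′ σ w i ≡ L′ σ' w i
  L′-cong w i σ≗σ' = allFin?-cong λ v → ⇒-congʳ (D w v) λ e → allFin?-cong λ j →
    cong (λ b → not (M w v i j) ∨ not b) (σ≗σ' e j)

  L′-antitone : ∀ {σ σ'} w i → (∀ {v} → T (D w v) → ∀ j → T (σ v j) → T (σ' v j)) →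
                T (L′ σ' w i) → T (L′ σ w i)
  L′-antitone w i σ⇒σ' t = allFin?⁻ λ v → ⇒-map (D w v) (λ e free → allFin?⁻ λ j →
    ⇒-map (M w v i j) (λ _ → not-antitone (σ⇒σ' e j)) (allFin?⁺ free j)) (allFin?⁺ t v)

  S-local : ∀ ξ ξ' (P : Fin n → Set) → (∀ {v w} → P v → T (D v w) → P w ⊎ S ξ w ≗ S ξ' w) →
            (∀ {v} → P v → ξ v ≗ ξ' v) → ∀ {v} → P v → S ξ v ≗ S ξ' v
  S-local ξ ξ' P closed agree {v} = go v (acyclic⇒wellFounded acyclic v)
    where
    go : ∀ v → Acc (λ w v → T (D v w)) v → P v → S ξ v ≗ S ξ' v
    go v (acc rec) pv i = begin
      S ξ v i                 ≡⟨ S-rec ξ v i ⟩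
      ξ v i ∧ L′ (S ξ) v i    ≡⟨ cong₂ _∧_ (agree pv i) (L′-cong v i successors) ⟩
      ξ' v i ∧ L′ (S ξ') v i  ≡⟨ S-rec ξ' v i ⟨
      S ξ' v i                ∎
      where
      open ≡-Reasoning
      successors : ∀ {w} → T (D v w) → S ξ w ≗ S ξ' w
      successors e with closed pv e
      ... | inj₁ pw   = go _ (rec e) pw
      ... | inj₂ S≗S' = S≗S'

  S-cong : ∀ {ξ ξ'} → (∀ v → ξ v ≗ ξ' v) → ∀ v → S ξ v ≗ S ξ' v
  S-cong {ξ} {ξ'} ξ≗ξ' v = S-local ξ ξ' (λ _ → ⊤) (λ _ _ → inj₁ tt) (λ {v} _ → ξ≗ξ' v) tt

  S-antitone : ∀ {ξ ξ'} w i → (T (ξ' w i) → T (ξ w i)) →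
               (∀ {v} → T (D w v) → ∀ j → T (S ξ v j) → T (S ξ' v j)) → T (S ξ' w i) → T (S ξ w i)
  S-antitone {ξ} {ξ'} w i ξ'⇒ξ S⇒S' t =
    let bit , free = Equivalence.to T-∧ (subst T (S-rec ξ' w i) t)
    in subst T (sym (S-rec ξ w i)) (Equivalence.from T-∧ (ξ'⇒ξ bit , L′-antitone w i S⇒S' free))

  module FromVertex (noEven : NoEvenShortcut D) (u : Fin n)
                    (inA : Fin n → Bool) (inA⇔ : ∀ v → T (inA v) ⇔ InA D u v) where

    A-closed : ∀ {v w} → T (inA v) → T (D v w) → T (inA w)
    A-closed {v} {w} v∈A e with u⇝v , v↛N⁺ ← Equivalence.to (inA⇔ v) v∈A =
      Equivalence.from (inA⇔ w)
        (reach u⇝v , λ (w′ , w′∈N⁺ , w⇝w′) → v↛N⁺ (w′ , w′∈N⁺ , inj₂ (extend w⇝w′)))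
      where
      reach : R⁺[ D ] u v → R⁺[ D ] u w
      reach (inj₁ refl)    = inj₂ (0 , step e here)
      reach (inj₂ (ℓ , p)) = inj₂ (ℓ ℕ.+ 1 , p ▷ e)
      extend : ∀ {w′} → R⁻[ D ] w′ w → R⁺ D v w′
      extend (inj₁ refl)    = 0 , step e here
      extend (inj₂ (ℓ , q)) = suc ℓ , step e q

    AgreeOutsideA : VSet n k → VSet n k → Set
    AgreeOutsideA σ σ' = ∀ v → ¬ T (inA v) → σ v ≗ σ' v

    N⁺∉A : ∀ {v} → T (D u v) → ¬ T (inA v)
    N⁺∉A {v} e v∈A = proj₂ (Equivalence.to (inA⇔ v) v∈A) (v , inj₂ e , inj₁ refl)

    OddWalk : Fin n → Set
    OddWalk v = ∃ λ ℓ → parity ℓ ≡ 1ℙ × Walk D u v ℓ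

    -- A vertex reached from u by walks of both parities cannot reach N⁺[u]: it would close a cycle
    -- through u, or give an even walk from u to an out-neighbour of u.
    walks-of-both-parities⇒∈A : ∀ {v ℓ₁ ℓ₂} → Walk D u v ℓ₁ → Walk D u v ℓ₂ →
                                parity ℓ₁ ≡ 1ℙ → parity ℓ₂ ≡ 0ℙ → T (inA v)
    walks-of-both-parities⇒∈A {v} {ℓ₁} {ℓ₂} p₁ p₂ odd even =
      Equivalence.from (inA⇔ v) (inj₂ (positive p₁ odd) , no-return)
      where
      positive : ∀ {ℓ} → Walk D u v ℓ → parity ℓ ≡ 1ℙ → R⁺ D u v
      positive {zero}  _ ()
      positive {suc ℓ} p _ = ℓ , p
      no-return : ¬ ∃ λ w → N⁺[ D ] u w × R⁻[ D ] w v
      no-return (w , inj₁ refl , v⇝u)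
        with ℓ , p ← positive p₁ odd | m , q ← R⁻[]⇒Walk v⇝u = acyclic u (ℓ ℕ.+ m) (p ++ʷ q)
      no-return (w , inj₂ e , v⇝w) with m , q ← R⁻[]⇒Walk v⇝w | parity m in par
      ... | 0ℙ = noEven u w e (ℓ₂ ℕ.+ m) (same-parity⇒Even-+ ℓ₂ m (trans even (sym par))) (p₂ ++ʷ q)
      ... | 1ℙ = noEven u w e (ℓ₁ ℕ.+ m) (same-parity⇒Even-+ ℓ₁ m (trans odd (sym par))) (p₁ ++ʷ q)

    odd⇒successor-not-odd : ∀ {w v} → ¬ T (inA v) → T (D w v) → OddWalk w → ¬ OddWalk v
    odd⇒successor-not-odd v∉A e (ℓ , odd , p) (ℓ′ , odd′ , q) =
      v∉A (walks-of-both-parities⇒∈A q (p ▷ e) odd′ (trans (+-homo-+ ℓ 1) (cong (ℙ._+ 1ℙ) odd)))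

    not-odd⇒successor-odd : ∀ {w v} → R⁺ D u w → T (D w v) → ¬ OddWalk w → OddWalk v
    not-odd⇒successor-odd (ℓ , p) e ¬odd with parity (suc ℓ) in par
    ... | 1ℙ = ⊥-elim (¬odd (suc ℓ , par , p))
    ... | 0ℙ = suc ℓ ℕ.+ 1 , trans (+-homo-+ (suc ℓ) 1) (cong (ℙ._+ 1ℙ) par) , p ▷ e

    module Conditioning (Q : VSet n k) (ξ₀ : Outcome n k) (ξ₀∈Φ : T (EventSA S inA Q ξ₀)) where

      Φ : Event n k
      Φ = EventSA S inA Q

      Φ⇒S≗Q : ∀ {ξ} → T (Φ ξ) → ∀ {a} → T (inA a) → S ξ a ≗ Q a
      Φ⇒S≗Q {ξ} t {a} a∈A i = not-xor (allFin?⁺ (⇒-elim (inA a) (allFin?⁺ t a) a∈A) i)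
        where
        not-xor : ∀ {b c} → T (not (b xor c)) → b ≡ c
        not-xor {true}  {true}  _ = refl
        not-xor {false} {false} _ = refl

      Φ-depends-on-A : ∀ ξ ξ' → (∀ v → T (inA v) → ξ v ≗ ξ' v) → Φ ξ ≡ Φ ξ'
      Φ-depends-on-A ξ ξ' agree = allFin?-cong λ a → ⇒-congʳ (inA a) λ a∈A → allFin?-cong λ i →
        cong (λ b → not (b xor Q a i)) (S-local ξ ξ' (T ∘ inA) (λ v∈A e → inj₁ (A-closed v∈A e)) (agree _) a∈A i)

      freeze : Outcome n k → Outcome n k
      freeze ξ v j = if inA v then ξ₀ v j else ξ v j

      freeze-∉A : ∀ ξ {v} → ¬ T (inA v) → freeze ξ v ≗ ξ v
      freeze-∉A ξ {v} v∉A j with inA v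
      ... | true  = ⊥-elim (v∉A tt)
      ... | false = refl

      S-freeze-A : ∀ ξ {v} → T (inA v) → S (freeze ξ) v ≗ S ξ₀ v
      S-freeze-A ξ = S-local (freeze ξ) ξ₀ (T ∘ inA) (λ v∈A e → inj₁ (A-closed v∈A e)) freeze-A
        where
        freeze-A : ∀ {v} → T (inA v) → freeze ξ v ≗ ξ₀ v
        freeze-A {v} v∈A j with inA v
        ... | true = refl

      S-freeze-cong : ∀ ξ ξ' → AgreeOutsideA ξ ξ' → ∀ v → S (freeze ξ) v ≗ S (freeze ξ') v
      S-freeze-cong ξ ξ' agree = S-cong freeze-agree
        where
        freeze-agree : ∀ v → freeze ξ v ≗ freeze ξ' v
        freeze-agree v j with inA v in v∈A
        ... | true  = refl
        ... | false = agree v (subst T v∈A) j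

      S≗S-freeze-outside-A : ∀ {ξ} → T (Φ ξ) → ∀ {v} → ¬ T (inA v) → S ξ v ≗ S (freeze ξ) v
      S≗S-freeze-outside-A {ξ} ξ∈Φ =
        S-local ξ (freeze ξ) (λ v → ¬ T (inA v)) successor (λ v∉A j → sym (freeze-∉A ξ v∉A j))
        where
        successor : ∀ {v w} → ¬ T (inA v) → T (D v w) → ¬ T (inA w) ⊎ S ξ w ≗ S (freeze ξ) w
        successor {w = w} _ _ with T? (inA w)
        ... | no  w∉A = inj₁ w∉A
        ... | yes w∈A = inj₂ λ j →
          trans (Φ⇒S≗Q ξ∈Φ w∈A j) (sym (trans (S-freeze-A ξ w∈A j) (Φ⇒S≗Q ξ₀∈Φ w∈A j)))

      _≤ξ_ : Outcome n k → Outcome n k → Set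
      ξ ≤ξ ξ' = ∀ v j → ξ v j ≼[ OddWalk v ] ξ' v j

      S-freeze-monotone : ∀ {ξ ξ'} → ξ ≤ξ ξ' → ∀ {w} → ¬ T (inA w) → R⁺ D u w →
                          ∀ i → S (freeze ξ) w i ≼[ OddWalk w ] S (freeze ξ') w i
      S-freeze-monotone {ξ} {ξ'} ξ≤ξ' {w} = go w (acyclic⇒wellFounded acyclic w)
        where
        S-freeze-agree : ∀ {v} → T (inA v) → S (freeze ξ) v ≗ S (freeze ξ') v
        S-freeze-agree v∈A j = trans (S-freeze-A ξ v∈A j) (sym (S-freeze-A ξ' v∈A j))
        go : ∀ w → Acc (λ w v → T (D v w)) w → ¬ T (inA w) → R⁺ D u w →
             ∀ i → S (freeze ξ) w i ≼[ OddWalk w ] S (freeze ξ') w i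
        go w (acc rec) w∉A (ℓ , u⇝w) i =
            (λ odd  → S-antitone w i (proj₁ bit odd) (up odd))
          , (λ ¬odd → S-antitone w i (proj₂ bit ¬odd) (down ¬odd))
          where
          bit : freeze ξ w i ≼[ OddWalk w ] freeze ξ' w i
          bit = subst₂ _≼[ OddWalk w ]_ (sym (freeze-∉A ξ w∉A i)) (sym (freeze-∉A ξ' w∉A i)) (ξ≤ξ' w i)
          up : OddWalk w → ∀ {v} → T (D w v) → ∀ j → T (S (freeze ξ) v j) → T (S (freeze ξ') v j)
          up odd {v} e j with T? (inA v)
          ... | yes v∈A = subst T (S-freeze-agree v∈A j)
          ... | no  v∉A = proj₂ (go v (rec e) v∉A (ℓ ℕ.+ 1 , u⇝w ▷ e) j)
                                (odd⇒successor-not-odd v∉A e odd)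
          down : ¬ OddWalk w → ∀ {v} → T (D w v) → ∀ j → T (S (freeze ξ') v j) → T (S (freeze ξ) v j)
          down ¬odd {v} e j with T? (inA v)
          ... | yes v∈A = subst T (sym (S-freeze-agree v∈A j))
          ... | no  v∉A = proj₁ (go v (rec e) v∉A (ℓ ℕ.+ 1 , u⇝w ▷ e) j)
                                (not-odd⇒successor-odd (ℓ , u⇝w) e ¬odd)

      module _ (p : Fin n → ℚ) (p∈[0,1] : ∀ v → 0ℚ ≤ p v × p v ≤ 1ℚ) (pos : 0ℚ < Pr p Φ) where

        open OutcomeSpace {n} {k} p p∈[0,1]

        CondPr-freeze : ∀ (h : VSet n k → Bool) → (∀ σ σ' → AgreeOutsideA σ σ' → h σ ≡ h σ') →
                        CondPr p (h ∘ S) Φ pos ≡ 𝔼Ω (λ ξ → ind (h (S (freeze ξ))))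
        CondPr-freeze h h-outside-A = Pr∩≡Pr*x⇒CondPr≡x p (h ∘ S) Φ pos (begin
          Pr p ((h ∘ S) ∩ᴱ Φ)
            ≡⟨ Pr≡𝔼Ω ((h ∘ S) ∩ᴱ Φ) ⟩
          𝔼Ω (λ ξ → ind (h (S ξ) ∧ Φ ξ))
            ≡⟨ 𝔼-cong (allOutcomes n k) (weight p) (λ ξ → ind-∧-guard (h (S ξ)) (Φ ξ) λ ξ∈Φ →
                 h-outside-A _ _ (λ v v∉A → S≗S-freeze-outside-A ξ∈Φ v∉A)) ⟩
          𝔼Ω (λ ξ → ind (Φ ξ) * ind (h (S (freeze ξ))))
            ≡⟨ 𝔼Ω-indep inA (ind ∘ Φ) (λ ξ → ind (h (S (freeze ξ))))
                 (λ ξ ξ' agree → cong ind (Φ-depends-on-A ξ ξ' agree))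
                 (λ ξ ξ' agree → cong ind (h-outside-A _ _ λ v _ → S-freeze-cong ξ ξ' agree v)) ⟩
          𝔼Ω (ind ∘ Φ) * 𝔼Ω (λ ξ → ind (h (S (freeze ξ))))
            ≡⟨ cong (_* 𝔼Ω (λ ξ → ind (h (S (freeze ξ))))) (Pr≡𝔼Ω Φ) ⟨
          Pr p Φ * 𝔼Ω (λ ξ → ind (h (S (freeze ξ)))) ∎)
          where open ≡-Reasoning

        module _ (Y : VSet n k) (Y⊆N⁺ : ∀ v j → T (Y v j) → T (D u v)) where

          avoidsᵇ : Fin n → Fin k → VSet n k → Bool
          avoidsᵇ v j σ = not (Y v j) ∨ not (σ v j)

          avoidsᵇ-outside-A : ∀ v j σ σ' → AgreeOutsideA σ σ' → avoidsᵇ v j σ ≡ avoidsᵇ v j σ'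
          avoidsᵇ-outside-A v j σ σ' agree = ⇒-congʳ (Y v j) λ y → cong not (agree v (N⁺∉A (Y⊆N⁺ v j y)) j)

          avoidsᵇ-monotone : ∀ v j → Monotone _≤ξ_ (λ ξ → ind (avoidsᵇ v j (S (freeze ξ))))
          avoidsᵇ-monotone v j ξ≤ξ' = ind-mono (⇒-map (Y v j) λ y → let e = Y⊆N⁺ v j y in
            not-antitone (proj₁ (S-freeze-monotone ξ≤ξ' (N⁺∉A e) (0 , step e here) j) (1 , refl , step e here)))

          CondPr-avoids : ∀ v j → (if Y v j then CondPr p (EventNotIn S v j) Φ pos else 1ℚ)
                                  ≡ 𝔼Ω (λ ξ → ind (not (Y v j) ∨ not (S (freeze ξ) v j)))
          CondPr-avoids v j with Y v j in y
          ... | true  = CondPr-freeze (λ σ → not (σ v j)) λ σ σ' agree →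
                          cong not (agree v (N⁺∉A (Y⊆N⁺ v j (subst T (sym y) tt))) j)
          ... | false = sym 𝔼Ω-mass

          avoidance : prodOver Y (λ v j → CondPr p (EventNotIn S v j) Φ pos) ≤ CondPr p (EventAvoid S Y) Φ pos
          avoidance = begin
            prodOver Y (λ v j → CondPr p (EventNotIn S v j) Φ pos)
              ≡⟨ cong prodℚ (map-cong (λ v → cong prodℚ (map-cong (CondPr-avoids v) (allFin k))) (allFin n)) ⟩
            prodℚ (map (λ v → prodℚ (map (λ j → 𝔼Ω (g v j)) (allFin k))) (allFin n))
              ≤⟨ harris-prod² (allOutcomes n k) (weight p) _≤ξ_ weight-nonNeg 𝔼Ω-mass
                   (harrisΩ (λ v → _≼[ OddWalk v ]_) (λ v → ≼-refl) (λ v → ≼-total))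
                   (allFin n) (allFin k) g (λ v j ξ → ind-nonNeg _) avoidsᵇ-monotone ⟩
            𝔼Ω (prodᶠ (allFin n) (λ v → prodᶠ (allFin k) (g v)))
              ≡⟨ 𝔼-cong (allOutcomes n k) (weight p) (λ ξ → ind-allFin² (λ v j → avoidsᵇ v j (S (freeze ξ)))) ⟨
            𝔼Ω (λ ξ → ind (EventAvoid S Y (freeze ξ)))
              ≡⟨ CondPr-freeze (λ σ → allFin? λ v → allFin? λ j → avoidsᵇ v j σ)
                   (λ σ σ' agree → allFin?-cong λ v → allFin?-cong λ j → avoidsᵇ-outside-A v j σ σ' agree) ⟨
            CondPr p (EventAvoid S Y) Φ pos ∎
            where
            open ≤-Reasoning
            g : Fin n → Fin k → Outcome n k → ℚ
            g v j ξ = ind (avoidsᵇ v j (S (freeze ξ)))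

lemma4p2 : ∀ {n k : ℕ} (D : Digraph n) (M : CrossEdges n k)
    → IsOrientation D → Acyclic D → NoEvenShortcut D
    → IsCover D M
    → (p : Fin n → ℚ) → (∀ v → 0ℚ ≤ p v × p v ≤ 1ℚ)
    → (S : Outcome n k → VSet n k) → IsSConstruction D M S
    → (u : Fin n)
    → (inA : Fin n → Bool) → (∀ v → T (inA v) ⇔ InA D u v)
    → (Q : VSet n k) → InQI M (InA D u) Q
    → (pos : 0ℚ < Pr p (EventSA S inA Q))
    → (Y : VSet n k) → (∀ v j → T (Y v j) → T (D u v))
    → prodOver Y (λ v j → CondPr p (EventNotIn S v j) (EventSA S inA Q) pos)
        ≤ CondPr p (EventAvoid S Y) (EventSA S inA Q) pos
lemma4p2 D M _ acyclic noEven _ p p∈[0,1] S S-rec u inA inA⇔ Q _ pos Y Y⊆N⁺ =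
  let ξ₀ , ξ₀∈Φ = Pr-witness p (EventSA S inA Q) pos
      open Construction D M acyclic S S-rec
      open FromVertex noEven u inA inA⇔
  in Conditioning.avoidance Q ξ₀ ξ₀∈Φ p p∈[0,1] pos Y Y⊆N⁺
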